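{- Let $n$ be an odd integer having a unique prime divisor $p'$ with $v_{p'}(n)=2$ and such that $v_q(n)=1$ for every prime divisor $q\neq p'$ of $n$. Let $A=S(n)$. Let $S=(x_1,\ldots,x_l)$ be a sequence in $\mathbb{Z}_n$ such that for every prime divisor $p$ of $n$, at least two terms of $S$ are coprime to $p$. Let $n'=n/p'^{\,2}$ and let $S'$ be the image of $S$ under the natural map $\mathbb{Z}_n\to\mathbb{Z}_{n'}$. Suppose at most one term of $S'$ is a unit. Then $S$ is an $A$-weighted zero-sum sequence.
   Context: $\mathbb{Z}_m=\mathbb{Z}/m\mathbb{Z}$, $U(m)$ its unit group; the natural map $\mathbb{Z}_n\to\mathbb{Z}_{n'}$ is reduction modulo $n'$. $v_p(n)=r$ means $p^r\mid n$, $p^{r+1}\nmid n$. For $A\subseteq\mathbb{Z}_n$, a sequence $(x_1,\ldots,x_l)$ is an $A$-weighted zero-sum sequence if $a_1x_1+\cdots+a_lx_l=0$ for some $a_i\in A$. For odd $n=\prod p_i^{r_i}$ and $a\in U(n)$, $\left(\frac{a}{n}\right)=\prod_i\left(\frac{a\bmod p_i}{p_i}\right)^{r_i}$ (Legendre symbols), and $S(n)$ is the kernel of $a\mapsto\left(\frac{a}{n}\right)$ on $U(n)$. -}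

module Defs where

open import Data.Nat using (ℕ; zero; suc; _+_; _*_; _^_; _%_)
open import Data.Nat.Divisibility using (_∣_; _∣?_)
open import Data.Nat.Primality using (Prime; prime?)
open import Data.Nat.Coprimality using (Coprime)
open import Data.Integer using (ℤ; 1ℤ; -1ℤ; 0ℤ) renaming (_*_ to _*ℤ_; _^_ to _^ℤ_)
open import Data.Fin using (Fin; toℕ)
open import Data.Fin.Properties using (any?)
open import Data.List using (List; upTo; filter; map; foldr; length)
open import Data.Product using (Σ; ∃; _×_)
open import Relation.Binary.PropositionalEquality using (_≡_)
open import Relation.Nullary using (Dec; yes; no; ¬_)
open import Relation.Nullary.Decidable using (_×-dec_)

-- reduction modulo m (reduction modulo 0 is the identity; never used with m = 0)
reduce : ℕ → ℕ → ℕ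
reduce zero    a = a
reduce (suc m) a = a % suc m

-- p-adic valuation v_p(n) for p ≥ 2, n ≥ 1: the number of k ∈ {1,…,n} with p^k ∣ n
val : ℕ → ℕ → ℕ
val p n = length (filter (λ k → (p ^ k) ∣? n) (map suc (upTo n)))

QR : ℕ → ℕ → Set
QR p a = ∃ λ (y : Fin p) → reduce p (toℕ y * toℕ y) ≡ reduce p a

QR? : (p a : ℕ) → Dec (QR p a)
QR? p a = any? (λ y → reduce p (toℕ y * toℕ y) Data.Nat.≟ reduce p a)
  where import Data.Nat

legendre : ℕ → ℕ → ℤ
legendre p a with p ∣? a
... | yes _ = 0ℤ
... | no _ with QR? p a
...   | yes _ = 1ℤ
...   | no _  = -1ℤ

primeDivisors : ℕ → List ℕ
primeDivisors n = filter (λ p → prime? p ×-dec (p ∣? n)) (upTo (suc n))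

jacobi : ℕ → ℕ → ℤ
jacobi n a = foldr (λ p r → (legendre p a ^ℤ val p n) *ℤ r) 1ℤ (primeDivisors n)

inS : (n : ℕ) → Fin n → Set
inS n a = Coprime (toℕ a) n × jacobi n (toℕ a) ≡ 1ℤ

sumFin : (l : ℕ) → (Fin l → ℕ) → ℕ
sumFin zero    f = 0
sumFin (suc l) f = f Fin.zero + sumFin l (λ i → f (Fin.suc i))
  where import Data.Fin as Fin

SWeightedZeroSum : (n l : ℕ) → (Fin l → Fin n) → Set
SWeightedZeroSum n l x =
  Σ (Fin l → Fin n) λ a → ((i : Fin l) → inS n (a i)) × (n ∣ sumFin l (λ i → toℕ (a i) * toℕ (x i)))

isUnitMod : ℕ → ℕ → Set
isUnitMod m a = Coprime (reduce m a) m

{-# OPTIONS --safe #-}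
module Submission where

-- Weights are built prime by prime.  For each prime p ∣ n the hypothesis on two terms prime to p
-- gives weights w_p, all prime to p and equal to 1 on the (at most one) term that is a unit of ℤ_n′,
-- such that p^(v_p n) divides ∑ w_p,i x_i.  A term that is not a unit of ℤ_n′ is divisible by a
-- prime q ∣ n′, which divides n exactly once; by the Chinese remainder theorem its weight can match
-- every w_p away from q and be either 1 or a quadratic nonresidue modulo q.  The two choices have
-- Jacobi symbols of opposite sign, so one of them lies in S(n).  The unit term gets weight 1.  The
-- resulting weighted sum is divisible by every p^(v_p n), hence by n.

open import Defs
open import Data.Bool using (if_then_else_)
open import Data.Empty using (⊥; ⊥-elim)
open import Data.Fin as Fin using (Fin; zero; suc; toℕ; fromℕ<)
open import Data.Fin.Properties using (any?; pigeonhole; toℕ-fromℕ<; toℕ<n)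
import Data.Fin.Properties as Finₚ
open import Data.Integer as ℤ using (ℤ; 1ℤ; -1ℤ)
import Data.Integer.Properties as ℤₚ
open import Data.List using (List; []; _∷_; map; foldr; filter; length; applyUpTo; upTo)
open import Data.List.Properties using (filter-accept; filter-none)
open import Data.List.Membership.Propositional using (_∈_)
open import Data.List.Membership.Propositional.Properties
  using (∈-map⁻; ∈-applyUpTo⁻; ∈-filter⁺; ∈-filter⁻; ∈-upTo⁺)
open import Data.List.Relation.Unary.All as All using (All; []; _∷_)
open import Data.List.Relation.Unary.Any using (here; there)
open import Data.List.Relation.Unary.AllPairs using (_∷_)
open import Data.List.Relation.Unary.Unique.Propositional using (Unique)
open import Data.List.Relation.Unary.Unique.Propositional.Properties using (filter⁺; upTo⁺)
open import Data.Nat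
open import Data.Nat.Coprimality
  using (Coprime; coprime?; 1-coprimeTo; coprime-Bézout; coprime-divisor; gcd≡1⇒coprime)
  renaming (sym to coprime-sym)
open import Data.Nat.DivMod hiding (_mod_)
open import Data.Nat.Divisibility
open import Data.Nat.GCD using (gcd; gcd[m,n]∣m; gcd[m,n]∣n; module Bézout)
open import Data.Nat.Induction using (<-rec)
open import Data.Nat.ListAction using (product)
open import Data.Nat.Primality
open import Data.Nat.Primality.Factorisation using (factorise)
open import Data.Nat.Properties
open import Data.Nat.Tactic.RingSolver using (solve-∀)
open import Data.Product using (Σ; ∃; ∃-syntax; _×_; _,_; proj₁; proj₂)
open import Data.Sum using (_⊎_; inj₁; inj₂)
open import Data.Vec.Functional using (updateAt)
open import Data.Vec.Functional.Properties using (updateAt-updates; updateAt-minimal)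
open import Function using (_∘_; const)
open import Relation.Binary.PropositionalEquality
  using (_≡_; _≢_; refl; sym; trans; cong; cong₂; subst; subst₂; module ≡-Reasoning)
open import Relation.Nullary using (¬_; Dec; yes; no; does)
open import Relation.Nullary.Decidable using (_×-dec_; ¬?; dec-true; dec-false)

-- Congruences

infix 4 _≡_mod_

_≡_mod_ : ℕ → ℕ → ℕ → Set
_≡_mod_ a b M = Σ ℕ λ j → Σ ℕ λ k → a + j * M ≡ b + k * M

≡mod-refl : ∀ {M a} → a ≡ a mod M
≡mod-refl = 0 , 0 , refl

≡mod-sym : ∀ {M a b} → a ≡ b mod M → b ≡ a mod M
≡mod-sym (j , k , e) = k , j , sym e

≡mod-trans : ∀ {M a b c} → a ≡ b mod M → b ≡ c mod M → a ≡ c mod M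
≡mod-trans {M} {a} {b} {c} (j , k , e) (j′ , k′ , e′) = j + j′ , k + k′ , (begin
  a + (j + j′) * M        ≡⟨ shift a j j′ M ⟩
  (a + j * M) + j′ * M    ≡⟨ cong (_+ j′ * M) e ⟩
  (b + k * M) + j′ * M    ≡⟨ swap b k j′ M ⟩
  (b + j′ * M) + k * M    ≡⟨ cong (_+ k * M) e′ ⟩
  (c + k′ * M) + k * M    ≡⟨ swap c k′ k M ⟩
  (c + k * M) + k′ * M    ≡⟨ shift c k k′ M ⟨
  c + (k + k′) * M        ∎)
  where
  open ≡-Reasoning
  shift : ∀ a j j′ M → a + (j + j′) * M ≡ (a + j * M) + j′ * M
  shift = solve-∀
  swap : ∀ b k j′ M → (b + k * M) + j′ * M ≡ (b + j′ * M) + k * M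
  swap = solve-∀

+-cong-mod : ∀ {M a b c d} → a ≡ b mod M → c ≡ d mod M → a + c ≡ b + d mod M
+-cong-mod {M} {a} {b} {c} {d} (j , k , e) (j′ , k′ , e′) = j + j′ , k + k′ , (begin
  a + c + (j + j′) * M          ≡⟨ regroup a c j j′ M ⟩
  (a + j * M) + (c + j′ * M)    ≡⟨ cong₂ _+_ e e′ ⟩
  (b + k * M) + (d + k′ * M)    ≡⟨ regroup b d k k′ M ⟨
  b + d + (k + k′) * M          ∎)
  where
  open ≡-Reasoning
  regroup : ∀ a c j j′ M → a + c + (j + j′) * M ≡ (a + j * M) + (c + j′ * M)
  regroup = solve-∀

*-congˡ-mod : ∀ {M a b} c → a ≡ b mod M → c * a ≡ c * b mod M
*-congˡ-mod {M} {a} {b} c (j , k , e) = c * j , c * k , (begin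
  c * a + c * j * M    ≡⟨ factor c a j M ⟩
  c * (a + j * M)      ≡⟨ cong (c *_) e ⟩
  c * (b + k * M)      ≡⟨ factor c b k M ⟨
  c * b + c * k * M    ∎)
  where
  open ≡-Reasoning
  factor : ∀ c a j M → c * a + c * j * M ≡ c * (a + j * M)
  factor = solve-∀

*-congʳ-mod : ∀ {M a b} c → a ≡ b mod M → a * c ≡ b * c mod M
*-congʳ-mod {M} {a} {b} c a≡b =
  subst₂ (λ u v → u ≡ v mod M) (*-comm c a) (*-comm c b) (*-congˡ-mod c a≡b)

m≡m%n-mod : ∀ a M .{{_ : NonZero M}} → a ≡ a % M mod M
m≡m%n-mod a M = 0 , a / M , trans (+-identityʳ a) (m≡m%n+[m/n]*n a M)

∣⇒≡0-mod : ∀ {M a} → M ∣ a → a ≡ 0 mod M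
∣⇒≡0-mod (divides q e) = 0 , q , trans (+-identityʳ _) e

≡0-mod⇒∣ : ∀ {M a} → a ≡ 0 mod M → M ∣ a
≡0-mod⇒∣ {M} {a} (j , k , e) =
  ∣m+n∣m⇒∣n (subst (M ∣_) (trans (sym e) (+-comm a _)) (n∣m*n k)) (n∣m*n j)

≡mod-resp-∣ : ∀ {M a b} → a ≡ b mod M → M ∣ a → M ∣ b
≡mod-resp-∣ a≡b M∣a = ≡0-mod⇒∣ (≡mod-trans (≡mod-sym a≡b) (∣⇒≡0-mod M∣a))

≡mod-divisor : ∀ {M d a b} → d ∣ M → a ≡ b mod M → a ≡ b mod d
≡mod-divisor {d = d} {a} {b} (divides q refl) (j , k , e) = j * q , k * q ,
  subst₂ _≡_ (cong (a +_) (sym (*-assoc j q d))) (cong (b +_) (sym (*-assoc k q d))) e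

≡mod⇒%≡ : ∀ {a b M} .{{_ : NonZero M}} → a ≡ b mod M → a % M ≡ b % M
≡mod⇒%≡ {a} {b} {M} (j , k , e) =
  trans (sym ([m+kn]%n≡m%n a j M)) (trans (cong (_% M) e) ([m+kn]%n≡m%n b k M))

≡mod-<⇒≡ : ∀ {a b M} → a < M → b < M → a ≡ b mod M → a ≡ b
≡mod-<⇒≡ {a} {b} {M@(suc _)} a<M b<M a≡b = begin
  a      ≡⟨ m<n⇒m%n≡m a<M ⟨
  a % M  ≡⟨ ≡mod⇒%≡ a≡b ⟩
  b % M  ≡⟨ m<n⇒m%n≡m b<M ⟩
  b      ∎
  where open ≡-Reasoning

-- Primes, coprimality and prime powers

prime>1 : ∀ {p} → Prime p → 1 < p
prime>1 {p} pr = nonTrivial⇒n>1 p {{prime⇒nonTrivial pr}}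

prime∤1 : ∀ {p} → Prime p → ¬ p ∣ 1
prime∤1 pr p∣1 = <⇒≢ (prime>1 pr) (sym (∣1⇒≡1 p∣1))

∃-prime-divisor : ∀ {d} → 1 < d → ∃[ r ] Prime r × r ∣ d
∃-prime-divisor {d@(suc _)} 1<d with factorise d
... | record { factors = [] ; isFactorisation = e } = ⊥-elim (<⇒≢ 1<d (sym e))
... | record { factors = r ∷ rs ; isFactorisation = e ; factorsPrime = pr ∷ _ } =
  r , pr , divides (product rs) (trans e (*-comm r _))

no-common-prime⇒coprime : ∀ {a b} → (∀ {r} → Prime r → r ∣ a → r ∣ b → ⊥) → Coprime a b
no-common-prime⇒coprime {a} {b} none {zero} (0∣a , 0∣b) =
  ⊥-elim (none prime[2] (2∣ a 0∣a) (2∣ b 0∣b))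
  where
  2∣ : ∀ c → 0 ∣ c → 2 ∣ c
  2∣ c 0∣c = subst (2 ∣_) (sym (0∣⇒≡0 0∣c)) (2 ∣0)
no-common-prime⇒coprime none {suc zero} _ = refl
no-common-prime⇒coprime none {d@(suc (suc _))} (d∣a , d∣b) with ∃-prime-divisor {d} (s≤s (s≤s z≤n))
... | r , pr , r∣d = ⊥-elim (none pr (∣-trans r∣d d∣a) (∣-trans r∣d d∣b))

¬coprime⇒common-prime : ∀ {a b} → ¬ Coprime a b → ∃[ r ] Prime r × r ∣ a × r ∣ b
¬coprime⇒common-prime {a} {b} ¬cop with gcd a b in eq
... | zero = 2 , prime[2] , 2∣ (gcd[m,n]∣m a b) , 2∣ (gcd[m,n]∣n a b)
  where
  2∣ : ∀ {c} → gcd a b ∣ c → 2 ∣ c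
  2∣ {c} g∣c = subst (2 ∣_) (sym (0∣⇒≡0 (subst (_∣ c) eq g∣c))) (2 ∣0)
... | suc zero = ⊥-elim (¬cop (gcd≡1⇒coprime eq))
... | g@(suc (suc _)) with ∃-prime-divisor {g} (s≤s (s≤s z≤n))
...   | r , pr , r∣g = r , pr , ∣-trans r∣g (subst (_∣ a) eq (gcd[m,n]∣m a b))
                              , ∣-trans r∣g (subst (_∣ b) eq (gcd[m,n]∣n a b))

coprime⇒∤ : ∀ {a n p} → Coprime a n → Prime p → p ∣ n → ¬ p ∣ a
coprime⇒∤ cop pp p∣n p∣a = <⇒≢ (prime>1 pp) (sym (cop (p∣a , p∣n)))

¬unit⇒common-prime : ∀ {m a} → ¬ isUnitMod m a → ∃[ r ] Prime r × r ∣ a × r ∣ m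
¬unit⇒common-prime {zero}  ¬unit = ¬coprime⇒common-prime ¬unit
¬unit⇒common-prime {suc m} ¬unit with ¬coprime⇒common-prime ¬unit
... | r , pr , r∣a%m , r∣m = r , pr , ∣n∣m%n⇒∣m r∣m r∣a%m , r∣m

odd⇒divisor≢2 : ∀ {n p} → n % 2 ≡ 1 → p ∣ n → p ≢ 2
odd⇒divisor≢2 {n} odd 2∣n refl = 0≢1+n (trans (sym (n∣m⇒m%n≡0 n 2 2∣n)) odd)

prime∣prime⇒≡ : ∀ {r p} → Prime r → Prime p → r ∣ p → r ≡ p
prime∣prime⇒≡ pr pp r∣p with prime⇒irreducible pp r∣p
... | inj₁ refl = ⊥-elim (<⇒≢ (prime>1 pr) refl)
... | inj₂ r≡p  = r≡p

prime∣^⇒∣ : ∀ {r p} k → Prime r → r ∣ p ^ k → r ∣ p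
prime∣^⇒∣ zero    pr r∣1 = ⊥-elim (prime∤1 pr r∣1)
prime∣^⇒∣ {p = p} (suc k) pr r∣p^k+1 with euclidsLemma p (p ^ k) pr r∣p^k+1
... | inj₁ r∣p   = r∣p
... | inj₂ r∣p^k = prime∣^⇒∣ k pr r∣p^k

prime∣prime^⇒≡ : ∀ {r p} k → Prime r → Prime p → r ∣ p ^ k → r ≡ p
prime∣prime^⇒≡ k pr pp r∣p^k = prime∣prime⇒≡ pr pp (prime∣^⇒∣ k pr r∣p^k)

prime∤⇒coprime-^ : ∀ {p a} k → Prime p → ¬ p ∣ a → Coprime a (p ^ k)
prime∤⇒coprime-^ {a = a} k pp p∤a = no-common-prime⇒coprime λ pr r∣a r∣p^k →
  p∤a (subst (_∣ a) (prime∣prime^⇒≡ k pr pp r∣p^k) r∣a)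

coprime⇒*-∣ : ∀ {a b N} → Coprime a b → a ∣ N → b ∣ N → a * b ∣ N
coprime⇒*-∣ {a} {b} cop a∣N (divides k refl) with coprime-divisor cop (subst (a ∣_) (*-comm k b) a∣N)
... | divides j refl = divides j (reassoc j a b)
  where
  reassoc : ∀ j a b → j * a * b ≡ j * (a * b)
  reassoc = solve-∀

^-monoʳ-∣ : ∀ m {j k} → j ≤ k → m ^ j ∣ m ^ k
^-monoʳ-∣ m {j} j≤k with m≤n⇒∃[o]m+o≡n j≤k
... | o , refl = subst (m ^ j ∣_) (sym (^-distribˡ-+-* m j o)) (m∣m*n (m ^ o))

p^k∣n⇒p^k∣p^j : ∀ p k j {n} → p ^ k ∣ n → ¬ p ^ suc j ∣ n → p ^ k ∣ p ^ j
p^k∣n⇒p^k∣p^j p k j p^k∣n p^j+1∤n with k ≤? j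
... | yes k≤j = ^-monoʳ-∣ p k≤j
... | no  k≰j = ⊥-elim (p^j+1∤n (∣-trans (^-monoʳ-∣ p (≰⇒> k≰j)) p^k∣n))

PrimePowerSplit : ℕ → ℕ → Set
PrimePowerSplit r d = ∃[ a ] ∃[ c ] d ≡ r ^ a * c × ¬ r ∣ c

prime-power-split : ∀ {r} d → Prime r → d ≢ 0 → PrimePowerSplit r d
prime-power-split {r} d pr = <-rec (λ d → d ≢ 0 → PrimePowerSplit r d) split d
  where
  split : ∀ d → (∀ {e} → e < d → e ≢ 0 → PrimePowerSplit r e) → d ≢ 0 → PrimePowerSplit r d
  split d rec d≢0 with r ∣? d
  ... | no r∤d = 0 , d , sym (+-identityʳ d) , r∤d
  ... | yes (divides e refl) = lift (rec (m<m*n e r {{≢-nonZero e≢0}} (prime>1 pr)) e≢0)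
    where
    e≢0 : e ≢ 0
    e≢0 refl = d≢0 refl
    lift : PrimePowerSplit r e → PrimePowerSplit r (e * r)
    lift (a , c , refl , r∤c) = suc a , c , rearrange (r ^ a) c r , r∤c
      where
      rearrange : ∀ x c r → x * c * r ≡ r * x * c
      rearrange = solve-∀

∣-from-prime-powers : ∀ {n N} .{{_ : NonZero n}} → (∀ {p} k → Prime p → p ^ k ∣ n → p ^ k ∣ N) → n ∣ N
∣-from-prime-powers {n} {N} prime-powers = <-rec (λ d → d ∣ n → d ∣ N) divisor n ∣-refl
  where
  divisor : ∀ d → (∀ {d′} → d′ < d → d′ ∣ n → d′ ∣ N) → d ∣ n → d ∣ N
  divisor zero          _   0∣n = ⊥-elim (≢-nonZero⁻¹ n (0∣⇒≡0 0∣n))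
  divisor (suc zero)    _   _   = 1∣ N
  divisor d@(suc (suc _)) rec d∣n with ∃-prime-divisor {d} (s≤s (s≤s z≤n))
  ... | r , pr , r∣d with prime-power-split d pr (λ ())
  ...   | a , c , d≡r^a*c , r∤c = subst (_∣ N) (sym d≡r^a*c)
    (coprime⇒*-∣ (coprime-sym (prime∤⇒coprime-^ a pr r∤c))
                 (prime-powers a pr (∣-trans (m∣m*n c) r^a*c∣n))
                 (rec c<d (∣-trans (n∣m*n (r ^ a)) r^a*c∣n)))
    where
    r^a*c∣n : r ^ a * c ∣ n
    r^a*c∣n = subst (_∣ n) d≡r^a*c d∣n
    c<d : c < d
    c<d = ≤∧≢⇒< (∣⇒≤ (subst (c ∣_) (sym d≡r^a*c) (n∣m*n (r ^ a))))
                (λ c≡d → r∤c (subst (r ∣_) (sym c≡d) r∣d))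

-- Linear congruences and the Chinese remainder theorem

inverse-mod : ∀ {a M} → Coprime a M → ∃[ u ] u * a ≡ 1 mod M
inverse-mod {a} {M} cop with coprime-Bézout cop
... | Bézout.+- x y eq = x , 0 , y , trans (+-identityʳ _) (sym eq)
inverse-mod {a} {zero}   cop | Bézout.-+ x y eq = ⊥-elim (1+n≢0 (trans eq (*-zeroʳ y)))
inverse-mod {a} {suc M′} cop | Bézout.-+ x y eq = M′ * x , 1 , M′ * y , (begin
  M′ * x * a + 1 * suc M′    ≡⟨ expand M′ x a ⟩
  M′ * (1 + x * a) + 1       ≡⟨ cong (λ z → M′ * z + 1) eq ⟩
  M′ * (y * suc M′) + 1      ≡⟨ collect M′ y ⟩
  1 + M′ * y * suc M′        ∎)
  where
  open ≡-Reasoning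
  expand : ∀ M′ x a → M′ * x * a + 1 * suc M′ ≡ M′ * (1 + x * a) + 1
  expand = solve-∀
  collect : ∀ M′ y → M′ * (y * suc M′) + 1 ≡ 1 + M′ * y * suc M′
  collect = solve-∀

linear-congruence : ∀ {a M} .{{_ : NonZero M}} → Coprime a M → ∀ R → ∃[ z ] M ∣ R + z * a
linear-congruence {a} {M@(suc M′)} cop R = R * M′ * u , ≡0-mod⇒∣ (≡mod-trans
  (+-cong-mod (≡mod-refl {a = R})
              (subst (_≡ R * M′ * 1 mod M) (sym (*-assoc (R * M′) u a)) (*-congˡ-mod (R * M′) ua≡1)))
  (subst (_≡ 0 mod M) (sym (collect R M′)) (∣⇒≡0-mod (n∣m*n R))))
  where
  u = proj₁ (inverse-mod cop)
  ua≡1 = proj₂ (inverse-mod cop)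
  collect : ∀ R M′ → R + R * M′ * 1 ≡ R * suc M′
  collect = solve-∀

crt₂ : ∀ {A B} → Coprime A B → ∀ r s → ∃[ t ] t ≡ r mod A × t ≡ s mod B
crt₂ {A} {B} cop r s =
  t , subst (λ z → t ≡ z mod A) (trans (+-identityʳ _) (*-identityʳ r))
        (+-cong-mod (*-congˡ-mod r vB≡1) (∣⇒≡0-mod (∣n⇒∣m*n s (n∣m*n u))))
    , subst (t ≡_mod B) (*-identityʳ s)
        (+-cong-mod (∣⇒≡0-mod (∣n⇒∣m*n r (n∣m*n v))) (*-congˡ-mod s uA≡1))
  where
  u = proj₁ (inverse-mod cop)
  uA≡1 = proj₂ (inverse-mod cop)
  v = proj₁ (inverse-mod (coprime-sym cop))
  vB≡1 = proj₂ (inverse-mod (coprime-sym cop))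
  t = r * (v * B) + s * (u * A)

module _ (e : ℕ → ℕ) where

  primePowerProduct : List ℕ → ℕ
  primePowerProduct ps = product (map (λ p → p ^ e p) ps)

  SimultaneousSolution : (ℕ → ℕ) → List ℕ → ℕ → Set
  SimultaneousSolution T ps t = All (λ p → t ≡ T p mod p ^ e p) ps

  ^∣primePowerProduct : ∀ {p ps} → p ∈ ps → p ^ e p ∣ primePowerProduct ps
  ^∣primePowerProduct (here refl) = m∣m*n _
  ^∣primePowerProduct {ps = q ∷ _} (there p∈ps) = ∣n⇒∣m*n (q ^ e q) (^∣primePowerProduct p∈ps)

  prime∣primePowerProduct : ∀ {r} ps → Prime r → All Prime ps → r ∣ primePowerProduct ps → r ∈ ps
  prime∣primePowerProduct []       pr []         r∣1 = ⊥-elim (prime∤1 pr r∣1)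
  prime∣primePowerProduct (p ∷ ps) pr (pp ∷ pps) r∣∏
    with euclidsLemma (p ^ e p) (primePowerProduct ps) pr r∣∏
  ... | inj₁ r∣p^e = here (prime∣prime^⇒≡ (e p) pr pp r∣p^e)
  ... | inj₂ r∣∏ps = there (prime∣primePowerProduct ps pr pps r∣∏ps)

  ^-coprime-primePowerProduct : ∀ {p ps} → Prime p → All Prime ps → All (p ≢_) ps
                              → Coprime (p ^ e p) (primePowerProduct ps)
  ^-coprime-primePowerProduct {p} {ps} pp pps p∉ps = no-common-prime⇒coprime λ pr r∣p^e r∣∏ →
    All.lookup p∉ps (prime∣primePowerProduct ps pr pps r∣∏) (sym (prime∣prime^⇒≡ (e p) pr pp r∣p^e))

  crt : (T : ℕ → ℕ) (ps : List ℕ) → Unique ps → All Prime ps → ∃ (SimultaneousSolution T ps)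
  crt T []       _           _          = 0 , []
  crt T (p ∷ ps) (p∉ps ∷ u) (pp ∷ pps) = extend (crt T ps u pps)
    where
    extend : ∃ (SimultaneousSolution T ps) → ∃ (SimultaneousSolution T (p ∷ ps))
    extend (t′ , t′≡T) = glue (crt₂ (^-coprime-primePowerProduct pp pps p∉ps) (T p) t′)
      where
      glue : ∃[ t ] t ≡ T p mod p ^ e p × t ≡ t′ mod primePowerProduct ps
           → ∃ (SimultaneousSolution T (p ∷ ps))
      glue (t , t≡Tp , t≡t′) = t , t≡Tp ∷ All.tabulate λ q∈ps →
        ≡mod-trans (≡mod-divisor (^∣primePowerProduct q∈ps) t≡t′) (All.lookup t′≡T q∈ps)

-- Finite sums

sumFin-cong : ∀ l {f g : Fin l → ℕ} → (∀ i → f i ≡ g i) → sumFin l f ≡ sumFin l g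
sumFin-cong zero    f≡g = refl
sumFin-cong (suc l) f≡g = cong₂ _+_ (f≡g zero) (sumFin-cong l (λ i → f≡g (suc i)))

sumFin-cong-mod : ∀ {M} l {f g : Fin l → ℕ} → (∀ i → f i ≡ g i mod M)
                → sumFin l f ≡ sumFin l g mod M
sumFin-cong-mod zero    f≡g = ≡mod-refl
sumFin-cong-mod (suc l) f≡g = +-cong-mod (f≡g zero) (sumFin-cong-mod l (λ i → f≡g (suc i)))

∣-sumFin : ∀ {d} l {f : Fin l → ℕ} → (∀ i → d ∣ f i) → d ∣ sumFin l f
∣-sumFin zero    d∣f = _ ∣0
∣-sumFin (suc l) d∣f = ∣m∣n⇒∣m+n (d∣f zero) (∣-sumFin l (λ i → d∣f (suc i)))

sumFin-except : ∀ l {f g : Fin l → ℕ} (J : Fin l) → (∀ i → i ≢ J → f i ≡ g i)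
              → sumFin l f + g J ≡ sumFin l g + f J
sumFin-except (suc l) {f} {g} zero f≡g = begin
  f zero + rest f + g zero   ≡⟨ cong (λ s → f zero + s + g zero) rest-equal ⟩
  f zero + rest g + g zero   ≡⟨ swap (f zero) (rest g) (g zero) ⟩
  g zero + rest g + f zero   ∎
  where
  open ≡-Reasoning
  rest : (Fin (suc l) → ℕ) → ℕ
  rest h = sumFin l (λ i → h (suc i))
  rest-equal : rest f ≡ rest g
  rest-equal = sumFin-cong l λ i → f≡g (suc i) λ ()
  swap : ∀ a s b → a + s + b ≡ b + s + a
  swap = solve-∀
sumFin-except (suc l) {f} {g} (suc J) f≡g = begin
  f zero + rest f + g (suc J)     ≡⟨ +-assoc (f zero) _ _ ⟩
  f zero + (rest f + g (suc J))   ≡⟨ cong₂ _+_ (f≡g zero λ ()) rest-except ⟩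
  g zero + (rest g + f (suc J))   ≡⟨ +-assoc (g zero) _ _ ⟨
  g zero + rest g + f (suc J)     ∎
  where
  open ≡-Reasoning
  rest : (Fin (suc l) → ℕ) → ℕ
  rest h = sumFin l (λ i → h (suc i))
  rest-except : rest f + g (suc J) ≡ rest g + f (suc J)
  rest-except = sumFin-except l J λ i i≢J → f≡g (suc i) (i≢J ∘ Finₚ.suc-injective)

∣-sumFin⇒∣-term : ∀ {d} l {f : Fin l → ℕ} (K : Fin l) → (∀ i → i ≢ K → d ∣ f i)
                → d ∣ sumFin l f → d ∣ f K
∣-sumFin⇒∣-term {d} l {f} K d∣others d∣Σ = ∣m+n∣m⇒∣n (subst (d ∣_) Σ≡ d∣Σ) (∣-sumFin l d∣g)
  where
  g = updateAt f K (const 0)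
  d∣g : ∀ i → d ∣ g i
  d∣g i with i Fin.≟ K
  ... | yes refl = subst (d ∣_) (sym (updateAt-updates K f)) (d ∣0)
  ... | no  i≢K  = subst (d ∣_) (sym (updateAt-minimal i K f i≢K)) (d∣others i i≢K)
  Σ≡ : sumFin l f ≡ sumFin l g + f K
  Σ≡ = trans (sym (+-identityʳ _)) (trans (cong (sumFin l f +_) (sym (updateAt-updates K f)))
         (sumFin-except l K (λ i i≢K → sym (updateAt-minimal i K f i≢K))))

onesExcept : ∀ {l} → Fin l → Fin l → ℕ
onesExcept J = updateAt (const 1) J (const 0)

onesExcept-≡0 : ∀ {l} (J : Fin l) → onesExcept J J ≡ 0
onesExcept-≡0 J = updateAt-updates J (const 1)

onesExcept-≡1 : ∀ {l} {i J : Fin l} → i ≢ J → onesExcept J i ≡ 1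
onesExcept-≡1 {i = i} {J} i≢J = updateAt-minimal i J (const 1) i≢J

-- Legendre and Jacobi symbols

val≡1 : ∀ {q n} → q ∣ n → ¬ q ^ 2 ∣ n → val q n ≡ 1
val≡1 {q} {zero}  _   q²∤0 = ⊥-elim (q²∤0 (_ ∣0))
val≡1 {q} {suc n} q∣n q²∤n =
  cong length (trans (filter-accept divides? (subst (_∣ suc n) (sym (*-identityʳ q)) q∣n))
                     (cong (1 ∷_) (filter-none divides? (All.tabulate q^k∤n))))
  where
  divides? = λ k → q ^ k ∣? suc n
  q^k∤n : ∀ {k} → k ∈ map suc (applyUpTo suc n) → ¬ q ^ k ∣ suc n
  q^k∤n k∈ with ∈-map⁻ suc k∈
  ... | j , j∈ , refl with ∈-applyUpTo⁻ suc j∈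
  ...   | i , _ , refl = λ q^k∣n → q²∤n (∣-trans (^-monoʳ-∣ q (m≤m+n 2 i)) q^k∣n)

∈-primeDivisors⁺ : ∀ {r n} .{{_ : NonZero n}} → Prime r → r ∣ n → r ∈ primeDivisors n
∈-primeDivisors⁺ {n = n} pr r∣n =
  ∈-filter⁺ (λ p → prime? p ×-dec (p ∣? n)) (∈-upTo⁺ (s≤s (∣⇒≤ r∣n))) (pr , r∣n)

∈-primeDivisors⁻ : ∀ {r n} → r ∈ primeDivisors n → Prime r × r ∣ n
∈-primeDivisors⁻ {n = n} r∈ =
  proj₂ (∈-filter⁻ (λ p → prime? p ×-dec (p ∣? n)) {xs = upTo (suc n)} r∈)

primeDivisors-unique : ∀ n → Unique (primeDivisors n)
primeDivisors-unique n = filter⁺ (λ p → prime? p ×-dec (p ∣? n)) (upTo⁺ (suc n))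
IsSign : ℤ → Set
IsSign z = z ≡ 1ℤ ⊎ z ≡ -1ℤ

*-isSign : ∀ {x y} → IsSign x → IsSign y → IsSign (x ℤ.* y)
*-isSign (inj₁ refl) (inj₁ refl) = inj₁ refl
*-isSign (inj₁ refl) (inj₂ refl) = inj₂ refl
*-isSign (inj₂ refl) (inj₁ refl) = inj₂ refl
*-isSign (inj₂ refl) (inj₂ refl) = inj₁ refl

^-isSign : ∀ {x} k → IsSign x → IsSign (x ℤ.^ k)
^-isSign zero    _ = inj₁ refl
^-isSign (suc k) x± = *-isSign x± (^-isSign k x±)

1^k≡1 : ∀ k → 1ℤ ℤ.^ k ≡ 1ℤ
1^k≡1 zero    = refl
1^k≡1 (suc k) = trans (ℤₚ.*-identityˡ _) (1^k≡1 k)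

legendre-isSign : ∀ p a → ¬ p ∣ a → IsSign (legendre p a)
legendre-isSign p a p∤a with p ∣? a
... | yes p∣a = ⊥-elim (p∤a p∣a)
... | no _ with QR? p a
...   | yes _ = inj₁ refl
...   | no _  = inj₂ refl

legendre-nonresidue : ∀ p a → ¬ p ∣ a → ¬ QR p a → legendre p a ≡ -1ℤ
legendre-nonresidue p a p∤a ¬qr with p ∣? a
... | yes p∣a = ⊥-elim (p∤a p∣a)
... | no _ with QR? p a
...   | yes qr = ⊥-elim (¬qr qr)
...   | no _   = refl

legendre-1 : ∀ {p} → Prime p → legendre p 1 ≡ 1ℤ
legendre-1 {p@(suc (suc _))} pp with p ∣? 1
... | yes p∣1 = ⊥-elim (prime∤1 pp p∣1)
... | no _ with QR? p 1
...   | yes _  = refl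
...   | no ¬qr = ⊥-elim (¬qr (suc zero , refl))

legendre-cong-mod : ∀ {p a b} → Prime p → a ≡ b mod p → legendre p a ≡ legendre p b
legendre-cong-mod {p@(suc _)} {a} {b} _ a≡b with p ∣? a | p ∣? b
... | yes _   | yes _   = refl
... | yes p∣a | no p∤b  = ⊥-elim (p∤b (≡mod-resp-∣ a≡b p∣a))
... | no p∤a  | yes p∣b = ⊥-elim (p∤a (≡mod-resp-∣ (≡mod-sym a≡b) p∣b))
... | no _    | no _ with QR? p a | QR? p b
...   | yes _        | yes _   = refl
...   | no _         | no _    = refl
...   | yes (y , qr) | no ¬qr  = ⊥-elim (¬qr (y , trans qr (≡mod⇒%≡ a≡b)))
...   | no ¬qr       | yes (y , qr) = ⊥-elim (¬qr (y , trans qr (sym (≡mod⇒%≡ a≡b))))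

module _ (n : ℕ) where

  -- jacobi n a unfolds to jacobiProduct (primeDivisors n) a.
  jacobiProduct : List ℕ → ℕ → ℤ
  jacobiProduct ps a = foldr (λ p r → (legendre p a ℤ.^ val p n) ℤ.* r) 1ℤ ps

  jacobiProduct-≡1 : ∀ {a} ps → All (λ p → legendre p a ≡ 1ℤ) ps → jacobiProduct ps a ≡ 1ℤ
  jacobiProduct-≡1 []       []           = refl
  jacobiProduct-≡1 (p ∷ ps) (Lp≡1 ∷ L≡1)
    rewrite Lp≡1 | jacobiProduct-≡1 ps L≡1 | 1^k≡1 (val p n) = refl

  jacobiProduct-isSign : ∀ {a} ps → All (λ p → ¬ p ∣ a) ps → IsSign (jacobiProduct ps a)
  jacobiProduct-isSign []       []         = inj₁ refl
  jacobiProduct-isSign {a} (p ∷ ps) (p∤a ∷ ∤a) =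
    *-isSign (^-isSign (val p n) (legendre-isSign p a p∤a)) (jacobiProduct-isSign ps ∤a)

  jacobiProduct-cong : ∀ {a b} ps → All (λ p → legendre p a ≡ legendre p b) ps
                     → jacobiProduct ps a ≡ jacobiProduct ps b
  jacobiProduct-cong []       []            = refl
  jacobiProduct-cong (p ∷ ps) (La≡Lb ∷ L≡L) rewrite La≡Lb | jacobiProduct-cong ps L≡L = refl

  jacobiProduct-flip : ∀ {a b q} ps → Unique ps → q ∈ ps
                     → All (λ p → p ≢ q → legendre p a ≡ legendre p b) ps
                     → legendre q b ℤ.^ val q n ≡ ℤ.- (legendre q a ℤ.^ val q n)
                     → jacobiProduct ps b ≡ ℤ.- jacobiProduct ps a
  jacobiProduct-flip {a} {b} {q} (q ∷ ps) (q∉ps ∷ _) (here refl) (_ ∷ L≡L) flip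
    rewrite flip
          | jacobiProduct-cong ps (All.zipWith (λ (q≢p , L≡L′) → L≡L′ (q≢p ∘ sym)) (q∉ps , L≡L)) =
    sym (ℤₚ.neg-distribˡ-* (legendre q a ℤ.^ val q n) (jacobiProduct ps b))
  jacobiProduct-flip {a} {b} (p ∷ ps) (p∉ps ∷ u) (there q∈ps) (La≡Lb ∷ L≡L) flip
    rewrite La≡Lb (All.lookup p∉ps q∈ps) | jacobiProduct-flip ps u q∈ps L≡L flip =
    sym (ℤₚ.neg-distribʳ-* (legendre p b ℤ.^ val p n) (jacobiProduct ps a))

  jacobiProduct-≡1-either : ∀ {a b q} ps → Unique ps → q ∈ ps → val q n ≡ 1
                          → All (λ p → ¬ p ∣ a) ps
                          → All (λ p → p ≢ q → legendre p a ≡ legendre p b) ps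
                          → legendre q a ≡ 1ℤ → legendre q b ≡ -1ℤ
                          → jacobiProduct ps a ≡ 1ℤ ⊎ jacobiProduct ps b ≡ 1ℤ
  jacobiProduct-≡1-either {a} {b} {q} ps u q∈ps vq≡1 ∤a L≡L La≡1 Lb≡-1 =
    decide (jacobiProduct-isSign ps ∤a)
    where
    flip : legendre q b ℤ.^ val q n ≡ ℤ.- (legendre q a ℤ.^ val q n)
    flip rewrite vq≡1 | La≡1 | Lb≡-1 = refl
    decide : IsSign (jacobiProduct ps a) → jacobiProduct ps a ≡ 1ℤ ⊎ jacobiProduct ps b ≡ 1ℤ
    decide (inj₁ Ja≡1)  = inj₁ Ja≡1
    decide (inj₂ Ja≡-1) = inj₂ (trans (jacobiProduct-flip ps u q∈ps L≡L flip) (cong ℤ.-_ Ja≡-1))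

-- Quadratic nonresidues

-- Modulo q = 2h + 1 the residues y and q − y have the same square, so every nonzero square has a
-- root in 1 … h; the 2h nonzero residues therefore cannot all be squares.
module _ (h : ℕ) where

  private
    q : ℕ
    q = suc (h + h)

  SmallRoot : ℕ → Set
  SmallRoot a = ∃[ k ] suc (toℕ {h} k) * suc (toℕ k) ≡ a mod q

  small-square-root : ∀ y → 0 < y → y < q → ∃[ z ] 0 < z × z ≤ h × z * z ≡ y * y mod q
  small-square-root y 0<y y<q with y ≤? h
  ... | yes y≤h = y , 0<y , y≤h , ≡mod-refl
  ... | no  y≰h = q ∸ y , m<n⇒0<n∸m y<q , q∸y≤h , (2 * y , q , reflect)
    where
    q∸y+y≡q : q ∸ y + y ≡ q
    q∸y+y≡q = m∸n+n≡m (<⇒≤ y<q)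
    q∸y≤h : q ∸ y ≤ h
    q∸y≤h = +-cancelʳ-≤ y (q ∸ y) h
      (subst (_≤ h + y) (trans (+-suc h h) (sym q∸y+y≡q)) (+-monoʳ-≤ h (≰⇒> y≰h)))
    square-identity : ∀ z y → z * z + 2 * y * (z + y) ≡ y * y + (z + y) * (z + y)
    square-identity = solve-∀
    reflect : (q ∸ y) * (q ∸ y) + 2 * y * q ≡ y * y + q * q
    reflect = subst (λ s → (q ∸ y) * (q ∸ y) + 2 * y * s ≡ y * y + s * s) q∸y+y≡q
                    (square-identity (q ∸ y) y)

  residue-small-root : ∀ a → 0 < a → a < q → QR q a → SmallRoot a
  residue-small-root a 0<a a<q (y , y²≡a) = lower (small-square-root (toℕ y) 0<y (toℕ<n y))
    where
    0<y : 0 < toℕ y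
    0<y with toℕ y
    ... | zero  = ⊥-elim (<⇒≢ 0<a (sym (trans (sym (m<n⇒m%n≡m a<q)) (sym y²≡a))))
    ... | suc _ = s≤s z≤n
    y²≡a-mod : toℕ y * toℕ y ≡ a mod q
    y²≡a-mod = ≡mod-trans (m≡m%n-mod _ q)
                          (subst (_≡ a mod q) (sym (trans y²≡a (m<n⇒m%n≡m a<q))) ≡mod-refl)
    lower : ∃[ z ] 0 < z × z ≤ h × z * z ≡ toℕ y * toℕ y mod q → SmallRoot a
    lower (suc z , _ , z<h , z²≡y²) = fromℕ< z<h ,
      subst (λ w → suc w * suc w ≡ a mod q) (sym (toℕ-fromℕ< z<h)) (≡mod-trans z²≡y² y²≡a-mod)

  ¬all-residues : 0 < h → ¬ (∀ a → 0 < a → a < q → QR q a)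
  ¬all-residues 0<h all-QR = collision (pigeonhole (m<m+n h 0<h) (proj₁ ∘ root))
    where
    root : (i : Fin (h + h)) → SmallRoot (suc (toℕ i))
    root i = residue-small-root (suc (toℕ i)) z<s (s<s (toℕ<n i)) (all-QR _ z<s (s<s (toℕ<n i)))
    collision : (∃[ i ] ∃[ j ] i Fin.< j × proj₁ (root i) ≡ proj₁ (root j)) → ⊥
    collision (i , j , i<j , ki≡kj) = <⇒≢ i<j (suc-injective (≡mod-<⇒≡ (s<s (toℕ<n i)) (s<s (toℕ<n j))
      (≡mod-trans (≡mod-sym (proj₂ (root i)))
                  (subst (λ k → suc (toℕ k) * suc (toℕ k) ≡ suc (toℕ j) mod q) (sym ki≡kj)
                         (proj₂ (root j))))))

odd-prime-form : ∀ {q} → Prime q → q ≢ 2 → ∃[ h ] 0 < h × q ≡ suc (h + h)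
odd-prime-form {q} pq q≢2 with q % 2 in q%2
... | zero        = ⊥-elim (q≢2 (sym (prime∣prime⇒≡ prime[2] pq (m%n≡0⇒n∣m q 2 q%2))))
... | suc (suc _) = ⊥-elim (<⇒≱ (m%n<n q 2) (subst (2 ≤_) (sym q%2) (s≤s (s≤s z≤n))))
... | suc zero    = h , 0<h , q≡2h+1
  where
  h = q / 2
  q≡2h+1 : q ≡ suc (h + h)
  q≡2h+1 = trans (m≡m%n+[m/n]*n q 2) (cong₂ _+_ q%2 (trans (*-comm h 2) (cong (h +_) (+-identityʳ h))))
  0<h : 0 < h
  0<h with h in h≡0
  ... | zero  = ⊥-elim (<⇒≢ (prime>1 pq) (sym (trans q≡2h+1 (cong (λ t → suc (t + t)) h≡0))))
  ... | suc _ = s≤s z≤n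

∃-nonresidue : ∀ {q} → Prime q → q ≢ 2 → ∃[ g ] ¬ q ∣ g × ¬ QR q g
∃-nonresidue pq q≢2 with odd-prime-form pq q≢2
... | h , 0<h , refl with any? (λ g → ¬? (suc (h + h) ∣? toℕ g) ×-dec ¬? (QR? (suc (h + h)) (toℕ g)))
...   | yes (g , nonresidue) = toℕ g , nonresidue
...   | no none = ⊥-elim (¬all-residues h 0<h all-QR)
  where
  all-QR : ∀ a → 0 < a → a < suc (h + h) → QR (suc (h + h)) a
  all-QR a 0<a a<q with QR? (suc (h + h)) a
  ... | yes qr = qr
  ... | no ¬qr = ⊥-elim (none (fromℕ< a<q ,
    subst (λ b → ¬ suc (h + h) ∣ b × ¬ QR (suc (h + h)) b) (sym (toℕ-fromℕ< a<q))
          ((λ q∣a → <⇒≱ a<q (∣⇒≤ {{>-nonZero 0<a}} q∣a)) , ¬qr)))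

-- Local weights

module _ {l} (y : Fin l → ℕ) where

  weighted : (Fin l → ℕ) → ℕ
  weighted b = sumFin l (λ i → b i * y i)

  weighted-updateAt : ∀ b J z → weighted (updateAt b J (const z)) + b J * y J ≡ weighted b + z * y J
  weighted-updateAt b J z =
    trans (sumFin-except l J (λ i i≢J → cong (_* y i) (updateAt-minimal i J b i≢J)))
          (cong (λ t → weighted b + t * y J) (updateAt-updates J b))

  LocalWeights : (p e : ℕ) → (Fin l → Set) → (Fin l → ℕ) → Set
  LocalWeights p e F w = (∀ i → ¬ p ∣ w i) × (∀ i → F i → w i ≡ 1) × p ^ suc e ∣ weighted w

module _ {p} (pp : Prime p) (p≢2 : p ≢ 2) (e : ℕ) {l} (y : Fin l → ℕ)
         {F : Fin l → Set} (F? : ∀ i → Dec (F i)) (F-unique : ∀ i j → F i → F j → i ≡ j) where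

  BaseWeights : Fin l → (Fin l → ℕ) → Set
  BaseWeights J b = b J ≡ 0 × (∀ i → i ≢ J → ¬ p ∣ b i) × (∀ i → F i → b i ≡ 1) × ¬ p ∣ weighted y b

  -- The weight at J solves a linear congruence modulo p^(e+1); it is prime to p because the rest
  -- of the sum is.
  base⇒localWeights : ∀ {J b} → ¬ F J → ¬ p ∣ y J → BaseWeights J b → ∃ (LocalWeights y p e F)
  base⇒localWeights {J} {b} ¬FJ p∤yJ (bJ≡0 , p∤b , b≡1 , p∤Σb) =
    w , p∤w , w≡1 , subst (p ^ suc e ∣_) (sym Σw≡) M∣Σ
    where
    instance
      _ = m^n≢0 p (suc e) {{prime⇒nonZero pp}}
    solution : ∃[ z ] p ^ suc e ∣ weighted y b + z * y J
    solution = linear-congruence (prime∤⇒coprime-^ (suc e) pp p∤yJ) (weighted y b)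
    z : ℕ
    z = proj₁ solution
    M∣Σ : p ^ suc e ∣ weighted y b + z * y J
    M∣Σ = proj₂ solution
    w : Fin l → ℕ
    w = updateAt b J (const z)
    Σw≡ : weighted y w ≡ weighted y b + z * y J
    Σw≡ = trans (sym (+-identityʳ _))
                (trans (cong (λ t → weighted y w + t * y J) (sym bJ≡0)) (weighted-updateAt y b J z))
    p∤z : ¬ p ∣ z
    p∤z p∣z = p∤Σb (∣m+n∣m⇒∣n (subst (p ∣_) (+-comm (weighted y b) _) (∣-trans (m∣m*n (p ^ e)) M∣Σ))
                              (∣m⇒∣m*n (y J) p∣z))
    p∤w : ∀ i → ¬ p ∣ w i
    p∤w i with i Fin.≟ J
    ... | yes refl = subst (λ t → ¬ p ∣ t) (sym (updateAt-updates J b)) p∤z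
    ... | no  i≢J  = subst (λ t → ¬ p ∣ t) (sym (updateAt-minimal i J b i≢J)) (p∤b i i≢J)
    w≡1 : ∀ i → F i → w i ≡ 1
    w≡1 i Fi = trans (updateAt-minimal i J b (λ { refl → ¬FJ Fi })) (b≡1 i Fi)

  onesExcept-base : ∀ {J} → ¬ F J → ¬ p ∣ weighted y (onesExcept J) → BaseWeights J (onesExcept J)
  onesExcept-base {J} ¬FJ p∤Σ =
    onesExcept-≡0 J , (λ i i≢J → subst (λ t → ¬ p ∣ t) (sym (onesExcept-≡1 i≢J)) (prime∤1 pp))
                    , (λ i Fi → onesExcept-≡1 {i = i} λ { refl → ¬FJ Fi }) , p∤Σ

  -- Raising the weight of a spare index k from 1 to 2 adds y k to the sum, so one of the two sums
  -- is prime to p.  This is where p ≢ 2 is used.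
  spare-baseWeights : ∀ {J k} → ¬ F J → k ≢ J → ¬ F k → ¬ p ∣ y k → ∃ (BaseWeights J)
  spare-baseWeights {J} {k} ¬FJ k≢J ¬Fk p∤yk with p ∣? weighted y (onesExcept J)
  ... | no  p∤Σ = onesExcept J , onesExcept-base ¬FJ p∤Σ
  ... | yes p∣Σ = b , bJ≡0 , p∤b , b-fixed , p∤Σb
    where
    open ≡-Reasoning
    b : Fin l → ℕ
    b = updateAt (onesExcept J) k (const 2)
    b≡1 : ∀ i → i ≢ k → i ≢ J → b i ≡ 1
    b≡1 i i≢k i≢J = trans (updateAt-minimal i k _ i≢k) (onesExcept-≡1 i≢J)
    bJ≡0 : b J ≡ 0
    bJ≡0 = trans (updateAt-minimal J k _ (k≢J ∘ sym)) (onesExcept-≡0 J)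
    p∤b : ∀ i → i ≢ J → ¬ p ∣ b i
    p∤b i i≢J with i Fin.≟ k
    ... | yes refl = subst (λ t → ¬ p ∣ t) (sym (updateAt-updates k (onesExcept J)))
                           (p≢2 ∘ prime∣prime⇒≡ pp prime[2])
    ... | no  i≢k  = subst (λ t → ¬ p ∣ t) (sym (b≡1 i i≢k i≢J)) (prime∤1 pp)
    b-fixed : ∀ i → F i → b i ≡ 1
    b-fixed i Fi = b≡1 i (λ { refl → ¬Fk Fi }) (λ { refl → ¬FJ Fi })
    Σb≡ : weighted y b ≡ weighted y (onesExcept J) + y k
    Σb≡ = +-cancelʳ-≡ (1 * y k) _ _ (begin
      weighted y b + 1 * y k                      ≡⟨ cong (λ t → weighted y b + t * y k)
                                                           (sym (onesExcept-≡1 k≢J)) ⟩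
      weighted y b + onesExcept J k * y k         ≡⟨ weighted-updateAt y (onesExcept J) k 2 ⟩
      weighted y (onesExcept J) + 2 * y k         ≡⟨ regroup (weighted y (onesExcept J)) (y k) ⟩
      weighted y (onesExcept J) + y k + 1 * y k   ∎)
      where
      regroup : ∀ s t → s + 2 * t ≡ s + t + 1 * t
      regroup = solve-∀
    p∤Σb : ¬ p ∣ weighted y b
    p∤Σb p∣Σb = p∤yk (∣m+n∣m⇒∣n (subst (p ∣_) Σb≡ p∣Σb) p∣Σ)

  -- Without a spare index every term other than K's is divisible by p: it is J's, or p ∣ y i,
  -- or it is the fixed index, which then must be K.
  no-spare-baseWeights : ∀ {J K} → J ≢ K → ¬ F J → ¬ p ∣ y K → ¬ (∃[ k ] k ≢ J × ¬ F k × ¬ p ∣ y k)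
                       → BaseWeights J (onesExcept J)
  no-spare-baseWeights {J} {K} J≢K ¬FJ p∤yK no-spare = onesExcept-base ¬FJ p∤Σ
    where
    FK : F K
    FK with F? K
    ... | yes FK = FK
    ... | no ¬FK = ⊥-elim (no-spare (K , J≢K ∘ sym , ¬FK , p∤yK))
    p∣others : ∀ i → i ≢ K → p ∣ onesExcept J i * y i
    p∣others i i≢K with i Fin.≟ J | p ∣? y i | F? i
    ... | yes refl | _        | _      = subst (λ t → p ∣ t * y i) (sym (onesExcept-≡0 J)) (p ∣0)
    ... | no _     | yes p∣yi | _      = ∣n⇒∣m*n (onesExcept J i) p∣yi
    ... | no _     | no _     | yes Fi = ⊥-elim (i≢K (F-unique i K Fi FK))
    ... | no i≢J   | no p∤yi  | no ¬Fi = ⊥-elim (no-spare (i , i≢J , ¬Fi , p∤yi))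
    p∤Σ : ¬ p ∣ weighted y (onesExcept J)
    p∤Σ p∣Σ = p∤yK (subst (p ∣_) (trans (cong (_* y K) (onesExcept-≡1 (J≢K ∘ sym))) (*-identityˡ (y K)))
                          (∣-sumFin⇒∣-term l K p∣others p∣Σ))

  ∃-baseWeights : ∀ {J K} → J ≢ K → ¬ F J → ¬ p ∣ y K → ∃ (BaseWeights J)
  ∃-baseWeights {J} J≢K ¬FJ p∤yK
    with any? (λ i → ¬? (i Fin.≟ J) ×-dec (¬? (F? i) ×-dec ¬? (p ∣? y i)))
  ... | yes (k , k≢J , ¬Fk , p∤yk) = spare-baseWeights ¬FJ k≢J ¬Fk p∤yk
  ... | no  no-spare               = onesExcept J , no-spare-baseWeights J≢K ¬FJ p∤yK no-spare

  ∃-localWeights : ∀ {i j} → i ≢ j → ¬ p ∣ y i → ¬ p ∣ y j → ∃ (LocalWeights y p e F)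
  ∃-localWeights {i} {j} i≢j p∤yi p∤yj with F? i
  ... | yes Fi = base⇒localWeights ¬Fj p∤yj (proj₂ (∃-baseWeights (i≢j ∘ sym) ¬Fj p∤yi))
    where
    ¬Fj : ¬ F j
    ¬Fj Fj = i≢j (F-unique i j Fi Fj)
  ... | no ¬Fi = base⇒localWeights ¬Fi p∤yi (proj₂ (∃-baseWeights i≢j ¬Fi p∤yj))

-- Global weights

module _ {n} .{{_ : NonZero n}} (e : ℕ → ℕ) (p^e∣n : ∀ {p} → Prime p → p ∣ n → p ^ suc (e p) ∣ n)
         {q} (pq : Prime q) (q∣n : q ∣ n)
         (T : ℕ → ℕ) (T-unit : ∀ {p} → Prime p → p ∣ n → p ≢ q → ¬ p ∣ T p) where

  private
    PD = primeDivisors n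
    PD-prime : ∀ {p} → p ∈ PD → Prime p
    PD-prime = proj₁ ∘ ∈-primeDivisors⁻ {n = n}
    PD-∣ : ∀ {p} → p ∈ PD → p ∣ n
    PD-∣ = proj₂ ∘ ∈-primeDivisors⁻ {n = n}
    target : ℕ → ℕ → ℕ
    target c p = if does (p ≟ q) then c else T p
    solution : ∀ c → ∃ (SimultaneousSolution (suc ∘ e) (target c) PD)
    solution c = crt (suc ∘ e) (target c) PD (primeDivisors-unique n) (All.tabulate PD-prime)

  candidate : ℕ → Fin n
  candidate c = fromℕ< (m%n<n (proj₁ (solution c)) n)

  candidate-≡target : ∀ c {p} → Prime p → p ∣ n → toℕ (candidate c) ≡ target c p mod p ^ suc (e p)
  candidate-≡target c pp p∣n = ≡mod-trans
    (≡mod-divisor (p^e∣n pp p∣n)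
                  (subst (_≡ t mod n) (sym (toℕ-fromℕ< (m%n<n t n))) (≡mod-sym (m≡m%n-mod t n))))
    (All.lookup (proj₂ (solution c)) (∈-primeDivisors⁺ pp p∣n))
    where
    t = proj₁ (solution c)

  candidate-≡T : ∀ c {p} → Prime p → p ∣ n → p ≢ q → toℕ (candidate c) ≡ T p mod p ^ suc (e p)
  candidate-≡T c {p} pp p∣n p≢q = subst (toℕ (candidate c) ≡_mod p ^ suc (e p))
    (cong (if_then c else T p) (dec-false (p ≟ q) p≢q)) (candidate-≡target c pp p∣n)

  candidate-≡c : ∀ c → toℕ (candidate c) ≡ c mod q
  candidate-≡c c = ≡mod-divisor (m∣m*n (q ^ e q)) (subst (toℕ (candidate c) ≡_mod q ^ suc (e q))
    (cong (if_then c else T q) (dec-true (q ≟ q) refl)) (candidate-≡target c pq q∣n))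

  candidate-coprime : ∀ c → ¬ q ∣ c → Coprime (toℕ (candidate c)) n
  candidate-coprime c q∤c = no-common-prime⇒coprime λ {r} pr r∣a r∣n → common-prime pr r∣a r∣n (r ≟ q)
    where
    common-prime : ∀ {r} → Prime r → r ∣ toℕ (candidate c) → r ∣ n → Dec (r ≡ q) → ⊥
    common-prime _  r∣a _   (yes refl) = q∤c (≡mod-resp-∣ (candidate-≡c c) r∣a)
    common-prime {r} pr r∣a r∣n (no r≢q) =
      T-unit pr r∣n r≢q (≡mod-resp-∣ (≡mod-divisor (m∣m*n (r ^ e r)) (candidate-≡T c pr r∣n r≢q)) r∣a)

  candidate-legendre : ∀ c d {p} → Prime p → p ∣ n → p ≢ q
                     → legendre p (toℕ (candidate c)) ≡ legendre p (toℕ (candidate d))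
  candidate-legendre c d {p} pp p∣n p≢q =
    trans (legendre-cong-mod pp (≡mod-divisor (m∣m*n (p ^ e p)) (candidate-≡T c pp p∣n p≢q)))
          (sym (legendre-cong-mod pp (≡mod-divisor (m∣m*n (p ^ e p)) (candidate-≡T d pp p∣n p≢q))))

  -- The candidates for 1 and for a nonresidue g differ only at the simple prime q, so their Jacobi
  -- symbols have opposite signs.
  ∃-inS-prescribed : q ≢ 2 → ¬ q ^ 2 ∣ n
                   → ∃[ a ] inS n a × (∀ {p} → Prime p → p ∣ n → p ≢ q → toℕ a ≡ T p mod p ^ suc (e p))
  ∃-inS-prescribed q≢2 q²∤n with ∃-nonresidue pq q≢2
  ... | g , q∤g , nonresidue = choose (jacobiProduct-≡1-either n PD (primeDivisors-unique n)
    (∈-primeDivisors⁺ pq q∣n) (val≡1 q∣n q²∤n)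
    (All.tabulate λ p∈ → coprime⇒∤ (candidate-coprime 1 (prime∤1 pq)) (PD-prime p∈) (PD-∣ p∈))
    (All.tabulate λ p∈ → candidate-legendre 1 g (PD-prime p∈) (PD-∣ p∈))
    (trans (legendre-cong-mod pq (candidate-≡c 1)) (legendre-1 pq))
    (trans (legendre-cong-mod pq (candidate-≡c g)) (legendre-nonresidue q g q∤g nonresidue)))
    where
    choose : jacobi n (toℕ (candidate 1)) ≡ 1ℤ ⊎ jacobi n (toℕ (candidate g)) ≡ 1ℤ
           → ∃[ a ] inS n a × (∀ {p} → Prime p → p ∣ n → p ≢ q → toℕ a ≡ T p mod p ^ suc (e p))
    choose (inj₁ J≡1) = candidate 1 , (candidate-coprime 1 (prime∤1 pq) , J≡1) , candidate-≡T 1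
    choose (inj₂ J≡1) = candidate g , (candidate-coprime g q∤g , J≡1) , candidate-≡T g

decidable-choice : ∀ {A W : Set} {P : A → Set} {Q : A → W → Set} → (∀ a → Dec (P a)) → W
                 → (∀ {a} → P a → ∃ (Q a)) → ∃[ f ] (∀ {a} → P a → Q a (f a))
decidable-choice {A} {W} {P} {Q} P? w₀ choose = f , f-spec
  where
  f : A → W
  f a with P? a
  ... | yes Pa = proj₁ (choose Pa)
  ... | no  _  = w₀
  f-spec : ∀ {a} → P a → Q a (f a)
  f-spec {a} Pa with P? a
  ... | yes Pa′ = proj₂ (choose Pa′)
  ... | no ¬Pa  = ⊥-elim (¬Pa Pa)

module _ {n l} (x : Fin l → Fin n) (1<n : 1 < n) {F : Fin l → Set} (F? : ∀ i → Dec (F i)) (e : ℕ → ℕ)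
         (p^e∣n : ∀ {p} → Prime p → p ∣ n → p ^ suc (e p) ∣ n)
         (p^e+2∤n : ∀ {p} → Prime p → p ∣ n → ¬ p ^ suc (suc (e p)) ∣ n)
         (L : ℕ → Fin l → ℕ)
         (L-local : ∀ {p} → Prime p → p ∣ n → LocalWeights (toℕ ∘ x) p (e p) F (L p))
         (simple-divisor : ∀ i → ¬ F i → ∃[ q ] Prime q × q ∣ toℕ (x i) × q ∣ n × q ≢ 2 × ¬ q ^ 2 ∣ n)
         where

  private
    instance
      n≢0 : NonZero n
      n≢0 = >-nonZero (<-trans z<s 1<n)
    y : Fin l → ℕ
    y = toℕ ∘ x

  GlobalWeight : Fin l → Fin n → Set
  GlobalWeight i a = inS n a × (∀ {p} → Prime p → p ∣ n → toℕ a * y i ≡ L p i * y i mod p ^ suc (e p))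

  fixed-globalWeight : ∀ i → F i → ∃ (GlobalWeight i)
  fixed-globalWeight i Fi = fromℕ< 1<n , subst GlobalWeight′ (sym (toℕ-fromℕ< 1<n))
    ( (1-coprimeTo n , jacobiProduct-≡1 n (primeDivisors n)
                         (All.tabulate (legendre-1 ∘ proj₁ ∘ ∈-primeDivisors⁻ {n = n})))
    , λ {p} pp p∣n → subst (λ t → 1 * y i ≡ t * y i mod p ^ suc (e p))
                           (sym (proj₁ (proj₂ (L-local pp p∣n)) i Fi)) ≡mod-refl)
    where
    GlobalWeight′ : ℕ → Set
    GlobalWeight′ t = (Coprime t n × jacobi n t ≡ 1ℤ)
                    × (∀ {p} → Prime p → p ∣ n → t * y i ≡ L p i * y i mod p ^ suc (e p))

  unfixed-globalWeight : ∀ i → ¬ F i → ∃ (GlobalWeight i)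
  unfixed-globalWeight i ¬Fi with simple-divisor i ¬Fi
  ... | q , pq , q∣y , q∣n , q≢2 , q²∤n =
    extend (∃-inS-prescribed e p^e∣n pq q∣n (λ p → L p i) (λ pp p∣n _ → proj₁ (L-local pp p∣n) i)
                             q≢2 q²∤n)
    where
    q^e∣q : q ^ suc (e q) ∣ q
    q^e∣q = ∣-trans (p^k∣n⇒p^k∣p^j q (suc (e q)) 1 (p^e∣n pq q∣n) q²∤n) (∣-reflexive (*-identityʳ q))
    extend : ∃[ a ] inS n a × (∀ {p} → Prime p → p ∣ n → p ≢ q → toℕ a ≡ L p i mod p ^ suc (e p))
           → ∃ (GlobalWeight i)
    extend (a , a∈S , a≡L) = a , a∈S , λ {p} pp p∣n → at (p ≟ q) pp p∣n
      where
      at : ∀ {p} → Dec (p ≡ q) → Prime p → p ∣ n → toℕ a * y i ≡ L p i * y i mod p ^ suc (e p)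
      at (yes refl) _ _ = ≡mod-trans (∣⇒≡0-mod (∣-trans q^e∣q (∣n⇒∣m*n (toℕ a) q∣y)))
                                     (≡mod-sym (∣⇒≡0-mod (∣-trans q^e∣q (∣n⇒∣m*n (L q i) q∣y))))
      at (no p≢q) pp p∣n = *-congʳ-mod (y i) (a≡L pp p∣n p≢q)

  globalWeight : ∀ i → ∃ (GlobalWeight i)
  globalWeight i with F? i
  ... | yes Fi = fixed-globalWeight i Fi
  ... | no ¬Fi = unfixed-globalWeight i ¬Fi

  weightedZeroSum : SWeightedZeroSum n l x
  weightedZeroSum = a , (λ i → proj₁ (proj₂ (globalWeight i))) , ∣-from-prime-powers prime-powers
    where
    a : Fin l → Fin n
    a i = proj₁ (globalWeight i)
    N = sumFin l (λ i → toℕ (a i) * y i)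
    p^e∣N : ∀ {p} → Prime p → p ∣ n → p ^ suc (e p) ∣ N
    p^e∣N pp p∣n =
      ≡mod-resp-∣ (≡mod-sym (sumFin-cong-mod l (λ i → proj₂ (proj₂ (globalWeight i)) pp p∣n)))
                  (proj₂ (proj₂ (L-local pp p∣n)))
    prime-powers : ∀ {p} k → Prime p → p ^ k ∣ n → p ^ k ∣ N
    prime-powers zero    _  _ = 1∣ N
    prime-powers {p} (suc k) pp p^k∣n =
      ∣-trans (p^k∣n⇒p^k∣p^j p (suc k) (suc (e p)) p^k∣n (p^e+2∤n pp p∣n)) (p^e∣N pp p∣n)
      where
      p∣n : p ∣ n
      p∣n = ∣-trans (m∣m*n (p ^ k)) p^k∣n

-- The shape of n in the theorem

module AlmostSquarefree {n p′} (odd : n % 2 ≡ 1) (pp′ : Prime p′)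
                        (p′²∣n : p′ ^ 2 ∣ n) (p′³∤n : ¬ p′ ^ 3 ∣ n)
                        (squarefree : ∀ q → Prime q → q ∣ n → q ≢ p′ → ¬ q ^ 2 ∣ n) where

  -- v_p(n) − 1 at the prime divisors of n
  exponent : ℕ → ℕ
  exponent p with p ≟ p′
  ... | yes _ = 1
  ... | no  _ = 0

  p^exponent∣n : ∀ {p} → Prime p → p ∣ n → p ^ suc (exponent p) ∣ n
  p^exponent∣n {p} _ p∣n with p ≟ p′
  ... | yes refl = p′²∣n
  ... | no  _    = subst (_∣ n) (sym (*-identityʳ p)) p∣n

  p^exponent+2∤n : ∀ {p} → Prime p → p ∣ n → ¬ p ^ suc (suc (exponent p)) ∣ n
  p^exponent+2∤n {p} pp p∣n with p ≟ p′
  ... | yes refl = p′³∤n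
  ... | no  p≢p′ = squarefree p pp p∣n p≢p′

  1<n : 1 < n
  1<n = ≤-trans (prime>1 pp′) (∣⇒≤ {{n≢0}} (m*n∣⇒m∣ p′ (p′ ^ 1) p′²∣n))
    where
    n≢0 : NonZero n
    n≢0 = ≢-nonZero λ { refl → 0≢1+n odd }

  nonunit⇒simple-prime-divisor : ∀ .{{_ : NonZero (p′ ^ 2)}} {a} → ¬ isUnitMod (n / p′ ^ 2) a
                               → ∃[ q ] Prime q × q ∣ a × q ∣ n × q ≢ 2 × ¬ q ^ 2 ∣ n
  nonunit⇒simple-prime-divisor ¬unit with ¬unit⇒common-prime ¬unit
  ... | q , pq , q∣a , q∣m = q , pq , q∣a , q∣n , odd⇒divisor≢2 odd q∣n , squarefree q pq q∣n q≢p′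
    where
    q∣n : q ∣ n
    q∣n = ∣-trans q∣m (m/n∣m p′²∣n)
    q≢p′ : q ≢ p′
    q≢p′ refl = p′³∤n (subst (p′ ^ 3 ∣_) (m/n*n≡m p′²∣n) (*-monoˡ-∣ (p′ ^ 2) q∣m))

lemma4p3 : (n p′ : ℕ) → n % 2 ≡ 1
  → Prime p′ → (p′ ^ 2) ∣ n → ¬ ((p′ ^ 3) ∣ n)
  → ((q : ℕ) → Prime q → q ∣ n → ¬ (q ≡ p′) → ¬ ((q ^ 2) ∣ n))
  → .{{_ : NonZero (p′ ^ 2)}}
  → (l : ℕ) (x : Fin l → Fin n)
  → ((p : ℕ) → Prime p → p ∣ n →
       Σ (Fin l) λ i → Σ (Fin l) λ j → ¬ (i ≡ j) × ¬ (p ∣ toℕ (x i)) × ¬ (p ∣ toℕ (x j)))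
  → ((i j : Fin l) → isUnitMod (n / (p′ ^ 2)) (toℕ (x i)) → isUnitMod (n / (p′ ^ 2)) (toℕ (x j)) → i ≡ j)
  → SWeightedZeroSum n l x
lemma4p3 n p′ odd pp′ p′²∣n p′³∤n squarefree l x two units-unique =
  weightedZeroSum x 1<n UnitImage? exponent p^exponent∣n p^exponent+2∤n
                  (proj₁ L) (λ pp p∣n → proj₂ L (pp , p∣n)) (λ _ → nonunit⇒simple-prime-divisor)
  where
  open AlmostSquarefree odd pp′ p′²∣n p′³∤n squarefree
  UnitImage : Fin l → Set
  UnitImage i = isUnitMod (n / p′ ^ 2) (toℕ (x i))
  UnitImage? : ∀ i → Dec (UnitImage i)
  UnitImage? i = coprime? _ _
  local : ∀ {p} → Prime p × p ∣ n → ∃ (LocalWeights (toℕ ∘ x) p (exponent p) UnitImage)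
  local {p} (pp , p∣n) with two p pp p∣n
  ... | i , j , i≢j , p∤xi , p∤xj =
    ∃-localWeights pp (odd⇒divisor≢2 odd p∣n) (exponent p) (toℕ ∘ x) UnitImage? units-unique
                   i≢j p∤xi p∤xj
  L = decidable-choice (λ p → prime? p ×-dec p ∣? n) (const 0) local
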